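{- Let $\mathsf{T}$ be the deductive system in the language $\{\to,\wedge,1\}$ with axioms (HL1) $p\to p$; (HL2) $(p\to q)\to((q\to r)\to(p\to r))$; (HL3) $(p\to(q\to r))\to(q\to(p\to r))$; (HL8) $1$; (HL9) $1\to(p\to p)$; (HL12) $p\wedge q\to p$; (HL13) $p\wedge q\to q$; (HL14) $(p\to q)\wedge(p\to r)\to(p\to q\wedge r)$, and rules (MP) from $p$, $p\to q$ infer $q$, and (Adj) from $p$, $q$ infer $p\wedge q$ (the $\{\to,\wedge,1\}$-fragment of linear logic). Then the equivalent algebraic semantics of $\mathsf{T}$ (with respect to the defining equation $p\wedge 1\approx 1$ and equivalence formulas $\{p\to q, q\to p\}$) is the quasivariety of Girard semilattices.
   Context: A (pointed) Girard semilattice is an algebra $\langle A,\to,\wedge,1\rangle$ such that $\langle A,\wedge,1\rangle$ is a meet-semilattice with a constant $1$ (with $\le$ the semilattice order) and for all $a,b,c\in A$: (L1) $1\to a=a$; (L2) $a\to a\ge 1$; (L3) $(a\to b)\wedge(a\to c)=a\to(b\wedge c)$; (L4) $a\to b\le (c\to a)\to(c\to b)$; (L5) $a\to(b\to c)\le b\to(a\to c)$; (L6) if $a\to b\ge 1$ and $b\to a\ge 1$ then $a=b$. The equivalent algebraic semantics is meant in the sense of Blok and Pigozzi. -}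

module Defs where

open import Level using (Level; _⊔_; 0ℓ) renaming (suc to lsuc)
open import Data.Nat using (ℕ)
open import Data.Product using (Σ; _×_; _,_; proj₁; proj₂)
open import Relation.Binary.PropositionalEquality using (_≡_)
open import Relation.Binary.Core using (Rel)
open import Relation.Binary.Structures using (IsEquivalence)
open import Algebra.Core using (Op₂)
import Algebra.Lattice.Structures as LS

infixr 5 _⇒_
infixr 6 _∧_

data Formula : Set where
  var : ℕ → Formula
  _⇒_ : Formula → Formula → Formula
  _∧_ : Formula → Formula → Formula
  𝟏   : Formula

infix 3 _⊢_

data _⊢_ (Γ : Formula → Set) : Formula → Set where
  hyp  : ∀ {φ} → Γ φ → Γ ⊢ φ
  HL1  : ∀ p → Γ ⊢ p ⇒ p
  HL2  : ∀ p q r → Γ ⊢ (p ⇒ q) ⇒ ((q ⇒ r) ⇒ (p ⇒ r))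
  HL3  : ∀ p q r → Γ ⊢ (p ⇒ (q ⇒ r)) ⇒ (q ⇒ (p ⇒ r))
  HL8  : Γ ⊢ 𝟏
  HL9  : ∀ p → Γ ⊢ 𝟏 ⇒ (p ⇒ p)
  HL12 : ∀ p q → Γ ⊢ (p ∧ q) ⇒ p
  HL13 : ∀ p q → Γ ⊢ (p ∧ q) ⇒ q
  HL14 : ∀ p q r → Γ ⊢ ((p ⇒ q) ∧ (p ⇒ r)) ⇒ (p ⇒ (q ∧ r))
  MP   : ∀ {p q} → Γ ⊢ p → Γ ⊢ p ⇒ q → Γ ⊢ q
  Adj  : ∀ {p q} → Γ ⊢ p → Γ ⊢ q → Γ ⊢ p ∧ q

record GirardSemilattice (c ℓ : Level) : Set (lsuc (c ⊔ ℓ)) where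
  infixr 5 _→ₐ_
  infixr 6 _∧ₐ_
  infix 4 _≈_ _≤_
  field
    Carrier : Set c
    _≈_     : Rel Carrier ℓ
    _→ₐ_    : Op₂ Carrier
    _∧ₐ_    : Op₂ Carrier
    1ₐ      : Carrier
    isMeetSemilattice : LS.IsMeetSemilattice _≈_ _∧ₐ_
    →-cong  : ∀ {a a′ b b′} → a ≈ a′ → b ≈ b′ → (a →ₐ b) ≈ (a′ →ₐ b′)

  _≤_ : Rel Carrier ℓ
  a ≤ b = (a ∧ₐ b) ≈ a

  field
    L1 : ∀ a → (1ₐ →ₐ a) ≈ a
    L2 : ∀ a → 1ₐ ≤ (a →ₐ a)
    L3 : ∀ a b c → ((a →ₐ b) ∧ₐ (a →ₐ c)) ≈ (a →ₐ (b ∧ₐ c))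
    L4 : ∀ a b c → (a →ₐ b) ≤ ((c →ₐ a) →ₐ (c →ₐ b))
    L5 : ∀ a b c → (a →ₐ (b →ₐ c)) ≤ (b →ₐ (a →ₐ c))
    L6 : ∀ a b → 1ₐ ≤ (a →ₐ b) → 1ₐ ≤ (b →ₐ a) → a ≈ b

  open LS.IsMeetSemilattice _≈_ isMeetSemilattice public
    using (isEquivalence; ∧-cong)

  ⟦_⟧ : Formula → (ℕ → Carrier) → Carrier
  ⟦ var n ⟧ h = h n
  ⟦ p ⇒ q ⟧ h = ⟦ p ⟧ h →ₐ ⟦ q ⟧ h
  ⟦ p ∧ q ⟧ h = ⟦ p ⟧ h ∧ₐ ⟦ q ⟧ h
  ⟦ 𝟏 ⟧ h = 1ₐ

Equation : Set
Equation = Formula × Formula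

_⊨GS[_,_]_ : (Equation → Set) → (c ℓ : Level) → Equation → Set (lsuc (c ⊔ ℓ))
Θ ⊨GS[ c , ℓ ] e =
  (A : GirardSemilattice c ℓ) (h : ℕ → GirardSemilattice.Carrier A) →
  (∀ {d} → Θ d →
     GirardSemilattice._≈_ A (GirardSemilattice.⟦_⟧ A (proj₁ d) h)
                             (GirardSemilattice.⟦_⟧ A (proj₂ d) h)) →
  GirardSemilattice._≈_ A (GirardSemilattice.⟦_⟧ A (proj₁ e) h)
                          (GirardSemilattice.⟦_⟧ A (proj₂ e) h)

E : Formula → Equation
E p = (p ∧ 𝟏 , 𝟏)

E[_] : (Formula → Set) → Equation → Set
E[ Γ ] d = Σ Formula (λ γ → Γ γ × (d ≡ E γ))

EΔ : Formula → Formula → Equation → Set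
EΔ p q d = (d ≡ E (p ⇒ q)) Data.Sum.⊎ (d ≡ E (q ⇒ p))
  where import Data.Sum

⟨_≈_⟩ : Formula → Formula → Equation → Set
⟨ p ≈ q ⟩ d = d ≡ (p , q)

-- Soundness: every axiom of T evaluates above 1 in a Girard semilattice, and
-- MP is sound because 1 ≤ a → b holds exactly when a ≤ b (this is where L6 is
-- used).  Completeness: the formulas modulo Γ-interderivability form a Girard
-- semilattice in which 1 ≤ [φ] holds exactly when Γ ⊢ φ.  The equivalence
-- formulas p → q, q → p hold at 1 exactly when p ≈ q, by L2 and L6.
module Submission where

open import Defs
open import Level using (Level; Lift; lift; lower)
open import Data.Nat using (ℕ)
open import Data.Product using (_×_; _,_; proj₁; proj₂)
open import Data.Sum using (inj₁; inj₂)
open import Function.Bundles using (_⇔_; mk⇔; module Equivalence)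
open import Relation.Binary.PropositionalEquality using (_≡_; refl; sym; subst; cong₂)
open import Relation.Binary.Structures using (IsEquivalence)
import Algebra.Lattice.Structures as LS
import Relation.Binary.Construct.NaturalOrder.Left as LeftNaturalOrder

module GirardSemilatticeProperties {c ℓ} (A : GirardSemilattice c ℓ) where
  open GirardSemilattice A
  open LS.IsMeetSemilattice _≈_ isMeetSemilattice
    using (isMagma; isSemigroup; idem; comm)
    renaming (refl to ≈-refl; sym to ≈-sym; trans to ≈-trans)
  private module Left = LeftNaturalOrder _≈_ _∧ₐ_

  -- Left's order is x ≈ x ∧ y, the symmetric form of _≤_.

  ≈⇒≤ : ∀ {a b} → a ≈ b → a ≤ b
  ≈⇒≤ a≈b = ≈-sym (Left.reflexive isMagma idem a≈b)

  ≤-trans : ∀ {a b c} → a ≤ b → b ≤ c → a ≤ c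
  ≤-trans a≤b b≤c = ≈-sym (Left.trans isSemigroup (≈-sym a≤b) (≈-sym b≤c))

  ≤-respʳ-≈ : ∀ {a b c} → a ≤ b → b ≈ c → a ≤ c
  ≤-respʳ-≈ a≤b b≈c = ≤-trans a≤b (≈⇒≤ b≈c)

  x∧y≤x : ∀ a b → (a ∧ₐ b) ≤ a
  x∧y≤x a b = ≈-sym (Left.x∙y≤x isMeetSemilattice a b)

  x∧y≤y : ∀ a b → (a ∧ₐ b) ≤ b
  x∧y≤y a b = ≈-sym (Left.x∙y≤y isMeetSemilattice a b)

  ∧-greatest : ∀ {a b c} → a ≤ b → a ≤ c → a ≤ (b ∧ₐ c)
  ∧-greatest a≤b a≤c = ≈-sym (Left.∙-presʳ-≤ isMeetSemilattice _ (≈-sym a≤b) (≈-sym a≤c))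

  1≤⇔∧1≈1 : ∀ {a} → 1ₐ ≤ a ⇔ (a ∧ₐ 1ₐ) ≈ 1ₐ
  1≤⇔∧1≈1 {a} = mk⇔ (≈-trans (comm a 1ₐ)) (≈-trans (comm 1ₐ a))

  →-monoʳ-≤ : ∀ {a b c} → b ≤ c → (a →ₐ b) ≤ (a →ₐ c)
  →-monoʳ-≤ {a} {b} {c} b≤c = ≈-trans (L3 a b c) (→-cong ≈-refl b≤c)

  ≤⇒1≤→ : ∀ {a b} → a ≤ b → 1ₐ ≤ (a →ₐ b)
  ≤⇒1≤→ {a} a≤b = ≤-trans (L2 a) (→-monoʳ-≤ a≤b)

  -- a ≤ b means a ≈ a ∧ b, which L6 yields from 1 ≤ a → a ∧ b and 1 ≤ a ∧ b → a.
  1≤→⇒≤ : ∀ {a b} → 1ₐ ≤ (a →ₐ b) → a ≤ b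
  1≤→⇒≤ {a} {b} 1≤a→b = ≈-sym (L6 a (a ∧ₐ b)
    (≤-respʳ-≈ (∧-greatest (L2 a) 1≤a→b) (L3 a a b))
    (≤⇒1≤→ (x∧y≤x a b)))

  ≈⇒1≤→ : ∀ {a b} → a ≈ b → 1ₐ ≤ (a →ₐ b)
  ≈⇒1≤→ {a} a≈b = ≤-respʳ-≈ (L2 a) (→-cong ≈-refl a≈b)

  ⊢⇒1≤⟦⟧ : ∀ {Γ φ} (h : ℕ → Carrier) →
    (∀ {γ} → Γ γ → 1ₐ ≤ ⟦ γ ⟧ h) → Γ ⊢ φ → 1ₐ ≤ ⟦ φ ⟧ h
  ⊢⇒1≤⟦⟧ h Γ-holds (hyp γ∈Γ)     = Γ-holds γ∈Γ
  ⊢⇒1≤⟦⟧ h Γ-holds (HL1 p)        = L2 _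
  ⊢⇒1≤⟦⟧ h Γ-holds (HL2 p q r)    = ≤-trans (≤⇒1≤→ (L4 _ _ _)) (L5 _ _ _)
  ⊢⇒1≤⟦⟧ h Γ-holds (HL3 p q r)    = ≤⇒1≤→ (L5 _ _ _)
  ⊢⇒1≤⟦⟧ h Γ-holds HL8            = ≈⇒≤ ≈-refl
  ⊢⇒1≤⟦⟧ h Γ-holds (HL9 p)        = ≤-respʳ-≈ (L2 _) (≈-sym (L1 _))
  ⊢⇒1≤⟦⟧ h Γ-holds (HL12 p q)     = ≤⇒1≤→ (x∧y≤x _ _)
  ⊢⇒1≤⟦⟧ h Γ-holds (HL13 p q)     = ≤⇒1≤→ (x∧y≤y _ _)
  ⊢⇒1≤⟦⟧ h Γ-holds (HL14 p q r)   = ≤⇒1≤→ (≈⇒≤ (L3 _ _ _))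
  ⊢⇒1≤⟦⟧ h Γ-holds (MP ⊢p ⊢p⇒q)   =
    ≤-trans (⊢⇒1≤⟦⟧ h Γ-holds ⊢p) (1≤→⇒≤ (⊢⇒1≤⟦⟧ h Γ-holds ⊢p⇒q))
  ⊢⇒1≤⟦⟧ h Γ-holds (Adj ⊢p ⊢q)    =
    ∧-greatest (⊢⇒1≤⟦⟧ h Γ-holds ⊢p) (⊢⇒1≤⟦⟧ h Γ-holds ⊢q)

module DerivedRules {Γ : Formula → Set} where

  ⇒-trans : ∀ {a b c} → Γ ⊢ a ⇒ b → Γ ⊢ b ⇒ c → Γ ⊢ a ⇒ c
  ⇒-trans {a} {b} {c} a⇒b b⇒c = MP b⇒c (MP a⇒b (HL2 a b c))

  ⇒-exchange : ∀ {a b c} → Γ ⊢ a ⇒ (b ⇒ c) → Γ ⊢ b ⇒ (a ⇒ c)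
  ⇒-exchange {a} {b} {c} a⇒b⇒c = MP a⇒b⇒c (HL3 a b c)

  ⇒-∧-intro : ∀ {a b c} → Γ ⊢ a ⇒ b → Γ ⊢ a ⇒ c → Γ ⊢ a ⇒ (b ∧ c)
  ⇒-∧-intro {a} {b} {c} a⇒b a⇒c = MP (Adj a⇒b a⇒c) (HL14 a b c)

  ⇒-monoʳ : ∀ {a b b′} → Γ ⊢ b ⇒ b′ → Γ ⊢ (a ⇒ b) ⇒ (a ⇒ b′)
  ⇒-monoʳ {a} {b} {b′} b⇒b′ = MP b⇒b′ (⇒-exchange (HL2 a b b′))

  ⇒-antitoneˡ : ∀ {a a′ b} → Γ ⊢ a′ ⇒ a → Γ ⊢ (a ⇒ b) ⇒ (a′ ⇒ b)
  ⇒-antitoneˡ {a} {a′} {b} a′⇒a = MP a′⇒a (HL2 a′ a b)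

  ∧-mono : ∀ {a a′ b b′} → Γ ⊢ a ⇒ a′ → Γ ⊢ b ⇒ b′ → Γ ⊢ (a ∧ b) ⇒ (a′ ∧ b′)
  ∧-mono a⇒a′ b⇒b′ = ⇒-∧-intro (⇒-trans (HL12 _ _) a⇒a′) (⇒-trans (HL13 _ _) b⇒b′)

  𝟏⇒-intro : ∀ {a} → Γ ⊢ a ⇒ (𝟏 ⇒ a)
  𝟏⇒-intro {a} = ⇒-exchange (HL9 a)

  𝟏⇒-elim : ∀ {a} → Γ ⊢ (𝟏 ⇒ a) ⇒ a
  𝟏⇒-elim {a} = MP HL8 (⇒-exchange (HL1 (𝟏 ⇒ a)))

module LindenbaumAlgebra (c ℓ : Level) (Γ : Formula → Set) where
  open DerivedRules {Γ}

  Carrier : Set c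
  Carrier = Lift c Formula

  infix 4 _≈_ _≤_

  _≈_ : Carrier → Carrier → Set ℓ
  lift a ≈ lift b = Lift ℓ ((Γ ⊢ a ⇒ b) × (Γ ⊢ b ⇒ a))

  _→ₗ_ : Carrier → Carrier → Carrier
  lift a →ₗ lift b = lift (a ⇒ b)

  _∧ₗ_ : Carrier → Carrier → Carrier
  lift a ∧ₗ lift b = lift (a ∧ b)

  _≤_ : Carrier → Carrier → Set ℓ
  x ≤ y = (x ∧ₗ y) ≈ x

  ⊢⇒⇒≤ : ∀ {a b} → Γ ⊢ a ⇒ b → lift a ≤ lift b
  ⊢⇒⇒≤ a⇒b = lift (HL12 _ _ , ⇒-∧-intro (HL1 _) a⇒b)

  1≤⇒⊢ : ∀ {x} → lift 𝟏 ≤ x → Γ ⊢ lower x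
  1≤⇒⊢ (lift (_ , 𝟏⇒𝟏∧a)) = MP (MP HL8 𝟏⇒𝟏∧a) (HL13 _ _)

  ⊢⇒1≤ : ∀ {x} → Γ ⊢ lower x → lift 𝟏 ≤ x
  ⊢⇒1≤ ⊢a = ⊢⇒⇒≤ (MP ⊢a 𝟏⇒-intro)

  ≈-isEquivalence : IsEquivalence _≈_
  ≈-isEquivalence = record
    { refl  = lift (HL1 _ , HL1 _)
    ; sym   = λ { (lift (a⇒b , b⇒a)) → lift (b⇒a , a⇒b) }
    ; trans = λ { (lift (a⇒b , b⇒a)) (lift (b⇒c , c⇒b)) →
                  lift (⇒-trans a⇒b b⇒c , ⇒-trans c⇒b b⇒a) }
    }

  ∧-isMeetSemilattice : LS.IsMeetSemilattice _≈_ _∧ₗ_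
  ∧-isMeetSemilattice = record
    { isBand = record
      { isSemigroup = record
        { isMagma = record
          { isEquivalence = ≈-isEquivalence
          ; ∙-cong = λ { (lift (a⇒a′ , a′⇒a)) (lift (b⇒b′ , b′⇒b)) →
                         lift (∧-mono a⇒a′ b⇒b′ , ∧-mono a′⇒a b′⇒b) }
          }
        ; assoc = λ _ _ _ → lift
            ( ⇒-∧-intro (⇒-trans (HL12 _ _) (HL12 _ _))
                        (⇒-∧-intro (⇒-trans (HL12 _ _) (HL13 _ _)) (HL13 _ _))
            , ⇒-∧-intro (⇒-∧-intro (HL12 _ _) (⇒-trans (HL13 _ _) (HL12 _ _)))
                        (⇒-trans (HL13 _ _) (HL13 _ _)) )
        }
      ; idem = λ _ → lift (HL12 _ _ , ⇒-∧-intro (HL1 _) (HL1 _))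
      }
    ; comm = λ _ _ → lift ( ⇒-∧-intro (HL13 _ _) (HL12 _ _)
                          , ⇒-∧-intro (HL13 _ _) (HL12 _ _) )
    }

  girardSemilattice : GirardSemilattice c ℓ
  girardSemilattice = record
    { Carrier           = Carrier
    ; _≈_               = _≈_
    ; _→ₐ_              = _→ₗ_
    ; _∧ₐ_              = _∧ₗ_
    ; 1ₐ                = lift 𝟏
    ; isMeetSemilattice = ∧-isMeetSemilattice
    ; →-cong            = λ { (lift (a⇒a′ , a′⇒a)) (lift (b⇒b′ , b′⇒b)) →
        lift ( ⇒-trans (⇒-antitoneˡ a′⇒a) (⇒-monoʳ b⇒b′)
             , ⇒-trans (⇒-antitoneˡ a⇒a′) (⇒-monoʳ b′⇒b) ) }
    ; L1 = λ _ → lift (𝟏⇒-elim , 𝟏⇒-intro)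
    ; L2 = λ _ → ⊢⇒⇒≤ (HL9 _)
    ; L3 = λ _ _ _ → lift (HL14 _ _ _ , ⇒-∧-intro (⇒-monoʳ (HL12 _ _)) (⇒-monoʳ (HL13 _ _)))
    ; L4 = λ _ _ _ → ⊢⇒⇒≤ (⇒-exchange (HL2 _ _ _))
    ; L5 = λ _ _ _ → ⊢⇒⇒≤ (HL3 _ _ _)
    ; L6 = λ _ _ 1≤a→b 1≤b→a → lift (1≤⇒⊢ 1≤a→b , 1≤⇒⊢ 1≤b→a)
    }

  open GirardSemilattice girardSemilattice using (⟦_⟧)

  var-valuation : ℕ → Carrier
  var-valuation n = lift (var n)

  lower-⟦⟧-var : ∀ φ → lower (⟦ φ ⟧ var-valuation) ≡ φ
  lower-⟦⟧-var (var n) = refl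
  lower-⟦⟧-var (p ⇒ q) = cong₂ _⇒_ (lower-⟦⟧-var p) (lower-⟦⟧-var q)
  lower-⟦⟧-var (p ∧ q) = cong₂ _∧_ (lower-⟦⟧-var p) (lower-⟦⟧-var q)
  lower-⟦⟧-var 𝟏       = refl

  open GirardSemilatticeProperties girardSemilattice using (1≤⇔∧1≈1)

  ⊨E⇒⊢ : ∀ {φ} → E[ Γ ] ⊨GS[ c , ℓ ] E φ → Γ ⊢ φ
  ⊨E⇒⊢ {φ} ⊨Eφ =
    subst (Γ ⊢_) (lower-⟦⟧-var φ)
      (1≤⇒⊢ (Equivalence.from 1≤⇔∧1≈1 (⊨Eφ girardSemilattice var-valuation E[Γ]-holds)))
    where
    E[Γ]-holds : ∀ {d} → E[ Γ ] d → ⟦ proj₁ d ⟧ var-valuation ≈ ⟦ proj₂ d ⟧ var-valuation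
    E[Γ]-holds (γ , γ∈Γ , refl) =
      Equivalence.to 1≤⇔∧1≈1 (⊢⇒1≤ (subst (Γ ⊢_) (sym (lower-⟦⟧-var γ)) (hyp γ∈Γ)))

⊢⇒⊨E : ∀ {c ℓ Γ φ} → Γ ⊢ φ → E[ Γ ] ⊨GS[ c , ℓ ] E φ
⊢⇒⊨E ⊢φ A h E[Γ]-holds =
  Equivalence.to 1≤⇔∧1≈1
    (⊢⇒1≤⟦⟧ h (λ γ∈Γ → Equivalence.from 1≤⇔∧1≈1 (E[Γ]-holds (_ , γ∈Γ , refl))) ⊢φ)
  where open GirardSemilatticeProperties A

≈⊨EΔ : ∀ {c ℓ} p q (d : Equation) → EΔ p q d → ⟨ p ≈ q ⟩ ⊨GS[ c , ℓ ] d
≈⊨EΔ p q _ (inj₁ refl) A h p≈q = Equivalence.to 1≤⇔∧1≈1 (≈⇒1≤→ (p≈q refl))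
  where open GirardSemilatticeProperties A
≈⊨EΔ p q _ (inj₂ refl) A h p≈q = Equivalence.to 1≤⇔∧1≈1 (≈⇒1≤→ (IsEquivalence.sym isEquivalence (p≈q refl)))
  where open GirardSemilattice A using (isEquivalence)
        open GirardSemilatticeProperties A

EΔ⊨≈ : ∀ {c ℓ} p q → EΔ p q ⊨GS[ c , ℓ ] (p , q)
EΔ⊨≈ p q A h EΔ-holds = L6 _ _
  (Equivalence.from 1≤⇔∧1≈1 (EΔ-holds (inj₁ refl)))
  (Equivalence.from 1≤⇔∧1≈1 (EΔ-holds (inj₂ refl)))
  where open GirardSemilattice A
        open GirardSemilatticeProperties A

mainTheorem2 : (c ℓ : Level) →
    ((Γ : Formula → Set) (φ : Formula) → (Γ ⊢ φ) ⇔ (E[ Γ ] ⊨GS[ c , ℓ ] E φ))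
    × ((p q : Formula) →
        ((d : Equation) → EΔ p q d → ⟨ p ≈ q ⟩ ⊨GS[ c , ℓ ] d)
        × (EΔ p q ⊨GS[ c , ℓ ] (p , q)))
mainTheorem2 c ℓ =
    (λ Γ φ → mk⇔ ⊢⇒⊨E (LindenbaumAlgebra.⊨E⇒⊢ c ℓ Γ))
  , (λ p q → ≈⊨EΔ p q , EΔ⊨≈ p q)
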